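{- Let $T$ be the $\triangle$-tree of a Random Apollonian Network with $n$ vertices and let $D=0.07\log n$. Then asymptotically almost surely (as $n\to\infty$) $T$ has $3^{2D}$ nodes at depth $2D$.
   Context: A Random Apollonian Network (RAN) with $n$ vertices is built by starting with a triangle $\nu_1\nu_2\nu_3$ embedded in the plane and, in each of $n-3$ steps, choosing a bounded face uniformly at random, adding a vertex inside it and joining it to the three vertices of that face (subdividing it). The $\triangle$-tree $T$ is the rooted tree whose nodes correspond to the triangles occurring during the process: the root corresponds to $\nu_1\nu_2\nu_3$, and when a triangle $\triangle$ is subdivided into $\triangle_1,\triangle_2,\triangle_3$, its node receives three children corresponding to them. The depth of a node is its distance to the root. Logarithms are natural. -}

module Defs where

open import Data.Nat using (ℕ; zero; suc; _+_; _*_; _∸_; _^_; _≤_)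
open import Data.Fin using (Fin; zero; suc; splitAt)
open import Data.Sum using (inj₁; inj₂)
open import Data.Product using (_×_)
open import Relation.Nullary using (¬_; yes; no)
open import Relation.Binary.PropositionalEquality using (_≡_)
open import Data.Nat using (_≟_)

-- The △-tree: a leaf is a current (bounded, not yet subdivided) face;
-- a subdivided triangle has three children.
data Tri : Set where
  leaf : Tri
  node : Tri → Tri → Tri → Tri

leaves : Tri → ℕ
leaves leaf = 1
leaves (node a b c) = leaves a + (leaves b + leaves c)

subdivide : (t : Tri) → Fin (leaves t) → Tri
subdivide leaf _ = node leaf leaf leaf
subdivide (node a b c) i with splitAt (leaves a) i
... | inj₁ i = node (subdivide a i) b c
... | inj₂ j with splitAt (leaves b) j
...   | inj₁ j' = node a (subdivide b j') c
...   | inj₂ k = node a b (subdivide c k)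

nodesAt : ℕ → Tri → ℕ
nodesAt zero _ = 1
nodesAt (suc d) leaf = 0
nodesAt (suc d) (node a b c) = nodesAt d a + (nodesAt d b + nodesAt d c)

sumFin : (m : ℕ) → (Fin m → ℕ) → ℕ
sumFin zero f = 0
sumFin (suc m) f = f zero + sumFin m (λ i → f (suc i))

-- Each choice sequence is equally likely (uniform face choice at each step).
goodRuns : ℕ → ℕ → Tri → ℕ
goodRuns d zero t with nodesAt d t ≟ 3 ^ d
... | yes _ = 1
... | no _ = 0
goodRuns d (suc s) t = sumFin (leaves t) (λ i → goodRuns d s (subdivide t i))

totalRuns : ℕ → Tri → ℕ
totalRuns zero t = 1
totalRuns (suc s) t = sumFin (leaves t) (λ i → totalRuns s (subdivide t i))

-- expS m N = N! * Σ_{j=0}^{N} m^j / j!   (a natural number)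
expS : ℕ → ℕ → ℕ
expS m zero = 1
expS m (suc N) = expS m N * suc N + m ^ suc N

fact : ℕ → ℕ
fact zero = 1
fact (suc N) = suc N * fact N

-- e^m ≤ x  iff every partial sum of the exponential series is ≤ x
ExpLe : ℕ → ℕ → Set
ExpLe m x = ∀ N → expS m N ≤ x * fact N

-- D = ⌊0.07 log n⌋ :  D ≤ 0.07 ln n ⇔ e^(100 D) ≤ n^7
IsD : ℕ → ℕ → Set
IsD n D = ExpLe (100 * D) (n ^ 7) × ¬ ExpLe (100 * suc D) (n ^ 7)

module Submission where

-- The △-tree is complete to depth d (it has 3^d nodes there) iff every leaf
-- has depth ≥ d.  Incompleteness is measured by the potential  weight d t,
-- the sum over leaves of depth j < d of 10^(d-1-j); it vanishes only on
-- complete trees, so the failed runs are bounded by the total final weight.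
-- Subdividing a leaf of weight w replaces it by three leaves of weight w/10;
-- summed over the L faces that may be chosen, the weight therefore shrinks
-- by the factor (10L-7)/(10L) per step (weight-drift).  From one face,
-- L = 1, 3, 5, ..., and the product of these factors over s steps is at most
-- (3/(3+s))^(1/3), by telescoping (1 - 7/(10L))^3 ≤ (L+5)/(L+7).  Hence the
-- failure probability is at most 10^d · (3/n)^(1/3) (failure-bound).  The analytic part turns D ≤ 0.07 ln n, i.e. e^(100 D) ≤ n^7, into
-- 3·(c·10^(2D))^3 ≤ n for large n (module Threshold), via the Stirling-type
-- bound x^x/x! ≥ c₀(53/20)^x, which follows from (1+1/k)^k ≥ 53/20 for
-- k ≥ 60 (a truncated binomial expansion), and (53/20)^100 > 2·10^42.
-- Corollary 8 combines failure-bound with Threshold.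

open import Defs
open import Data.Nat
open import Data.Nat.Properties
open import Data.Nat.Combinatorics using (_C_; nC1≡n; nCk+nC[k+1]≡[n+1]C[k+1])
open import Data.Nat.Tactic.RingSolver using (solve-∀)
open import Data.Fin using (Fin; zero; suc; splitAt; _↑ˡ_; _↑ʳ_)
open import Data.Fin.Properties using (splitAt-↑ˡ; splitAt-↑ʳ)
open import Data.Sum using (inj₁; inj₂)
open import Data.Product using (∃; _,_; proj₁)
open import Data.Unit using (tt)
open import Data.Empty using (⊥-elim)
open import Relation.Nullary using (yes; no)
open import Relation.Binary.PropositionalEquality

sumFin-split : ∀ m n (f : Fin (m + n) → ℕ) →
  sumFin (m + n) f ≡ sumFin m (λ i → f (i ↑ˡ n)) + sumFin n (λ j → f (m ↑ʳ j))
sumFin-split zero    n f = refl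
sumFin-split (suc m) n f =
  trans (cong (f zero +_) (sumFin-split m n (λ i → f (suc i)))) (sym (+-assoc (f zero) _ _))

sumFin-cong : ∀ m {f g : Fin m → ℕ} → (∀ i → f i ≡ g i) → sumFin m f ≡ sumFin m g
sumFin-cong zero    f≡g = refl
sumFin-cong (suc m) f≡g = cong₂ _+_ (f≡g zero) (sumFin-cong m (λ i → f≡g (suc i)))

sumFin-mono : ∀ m {f g : Fin m → ℕ} → (∀ i → f i ≤ g i) → sumFin m f ≤ sumFin m g
sumFin-mono zero    f≤g = z≤n
sumFin-mono (suc m) f≤g = +-mono-≤ (f≤g zero) (sumFin-mono m (λ i → f≤g (suc i)))

sumFin-distrib-+ : ∀ m (f g : Fin m → ℕ) →
  sumFin m (λ i → f i + g i) ≡ sumFin m f + sumFin m g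
sumFin-distrib-+ zero    f g = refl
sumFin-distrib-+ (suc m) f g =
  trans (cong (f zero + g zero +_) (sumFin-distrib-+ m (λ i → f (suc i)) (λ i → g (suc i))))
        (swap-middle (f zero) (g zero) _ _)
  where
  swap-middle : ∀ a b c d → a + b + (c + d) ≡ a + c + (b + d)
  swap-middle = solve-∀

sumFin-*ˡ : ∀ m c (f : Fin m → ℕ) → sumFin m (λ i → c * f i) ≡ c * sumFin m f
sumFin-*ˡ zero    c f = sym (*-zeroʳ c)
sumFin-*ˡ (suc m) c f =
  trans (cong (c * f zero +_) (sumFin-*ˡ m c (λ i → f (suc i)))) (sym (*-distribˡ-+ c (f zero) _))

sumFin-const : ∀ m c → sumFin m (λ _ → c) ≡ m * c
sumFin-const zero    c = refl
sumFin-const (suc m) c = cong (c +_) (sumFin-const m c)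

leaves-subdivide : ∀ t i → leaves (subdivide t i) ≡ 2 + leaves t
leaves-subdivide leaf i = refl
leaves-subdivide (node a b c) i with splitAt (leaves a) i
... | inj₁ i′ rewrite leaves-subdivide a i′ = refl
... | inj₂ j with splitAt (leaves b) j
...   | inj₁ j′ rewrite leaves-subdivide b j′ = middle (leaves a) (leaves b) (leaves c)
  where
  middle : ∀ x y z → x + (2 + y + z) ≡ 2 + (x + (y + z))
  middle = solve-∀
...   | inj₂ k rewrite leaves-subdivide c k = right (leaves a) (leaves b) (leaves c)
  where
  right : ∀ x y z → x + (y + (2 + z)) ≡ 2 + (x + (y + z))
  right = solve-∀

subdivide-left : ∀ a b c i →
  subdivide (node a b c) (i ↑ˡ (leaves b + leaves c)) ≡ node (subdivide a i) b c
subdivide-left a b c i rewrite splitAt-↑ˡ (leaves a) i (leaves b + leaves c) = refl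

subdivide-middle : ∀ a b c j →
  subdivide (node a b c) (leaves a ↑ʳ (j ↑ˡ leaves c)) ≡ node a (subdivide b j) c
subdivide-middle a b c j
  rewrite splitAt-↑ʳ (leaves a) (leaves b + leaves c) (j ↑ˡ leaves c)
        | splitAt-↑ˡ (leaves b) j (leaves c) = refl

subdivide-right : ∀ a b c k →
  subdivide (node a b c) (leaves a ↑ʳ (leaves b ↑ʳ k)) ≡ node a b (subdivide c k)
subdivide-right a b c k
  rewrite splitAt-↑ʳ (leaves a) (leaves b + leaves c) (leaves b ↑ʳ k)
        | splitAt-↑ʳ (leaves b) (leaves c) k = refl

sumFin-subdivide-node : ∀ a b c (F : Tri → ℕ) →
  sumFin (leaves (node a b c)) (λ i → F (subdivide (node a b c) i)) ≡
  sumFin (leaves a) (λ i → F (node (subdivide a i) b c)) +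
  (sumFin (leaves b) (λ j → F (node a (subdivide b j) c)) +
   sumFin (leaves c) (λ k → F (node a b (subdivide c k))))
sumFin-subdivide-node a b c F =
  trans (sumFin-split (leaves a) (leaves b + leaves c) _)
    (cong₂ _+_ (sumFin-cong (leaves a) (λ i → cong F (subdivide-left a b c i)))
      (trans (sumFin-split (leaves b) (leaves c) _)
        (cong₂ _+_ (sumFin-cong (leaves b) (λ j → cong F (subdivide-middle a b c j)))
                   (sumFin-cong (leaves c) (λ k → cong F (subdivide-right a b c k))))))

stepProduct : (ℕ → ℕ) → ℕ → ℕ → ℕ
stepProduct f zero    L = 1
stepProduct f (suc s) L = f L * stepProduct f s (2 + L)

totalRuns-product : ∀ s t → totalRuns s t ≡ stepProduct (λ L → L) s (leaves t)
totalRuns-product zero    t = refl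
totalRuns-product (suc s) t =
  trans (sumFin-cong (leaves t) (λ i →
           trans (totalRuns-product s (subdivide t i))
                 (cong (stepProduct (λ L → L) s) (leaves-subdivide t i))))
        (sumFin-const (leaves t) _)

stepProduct-scale : ∀ c f s L →
  c ^ s * stepProduct f s L ≡ stepProduct (λ L → c * f L) s L
stepProduct-scale c f zero    L = refl
stepProduct-scale c f (suc s) L =
  trans (exchange c (c ^ s) (f L) (stepProduct f s (2 + L)))
        (cong (c * f L *_) (stepProduct-scale c f s (2 + L)))
  where
  exchange : ∀ x y z w → x * y * (z * w) ≡ x * z * (y * w)
  exchange = solve-∀

^-distribʳ-* : ∀ a b n → (a * b) ^ n ≡ a ^ n * b ^ n
^-distribʳ-* a b zero    = refl
^-distribʳ-* a b (suc n) =
  trans (cong (a * b *_) (^-distribʳ-* a b n)) (exchange a b (a ^ n) (b ^ n))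
  where
  exchange : ∀ x y z w → x * y * (z * w) ≡ x * z * (y * w)
  exchange = solve-∀

stepProduct-telescope : ∀ (f h w : ℕ → ℕ) k →
  (∀ L → f L ^ k * w (2 + L) ≤ h L ^ k * w L) →
  ∀ s L → stepProduct f s L ^ k * w (2 * s + L) ≤ stepProduct h s L ^ k * w L
stepProduct-telescope f h w k step zero L = ≤-refl
stepProduct-telescope f h w k step (suc s) L = begin
    (f L * F) ^ k * w (2 * suc s + L)
      ≡⟨ cong₂ _*_ (^-distribʳ-* (f L) F k) (cong w (shift s L)) ⟩
    f L ^ k * F ^ k * w (2 * s + (2 + L))
      ≡⟨ *-assoc (f L ^ k) (F ^ k) _ ⟩
    f L ^ k * (F ^ k * w (2 * s + (2 + L)))
      ≤⟨ *-monoʳ-≤ (f L ^ k) (stepProduct-telescope f h w k step s (2 + L)) ⟩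
    f L ^ k * (H ^ k * w (2 + L))
      ≡⟨ swap (f L ^ k) (H ^ k) (w (2 + L)) ⟩
    H ^ k * (f L ^ k * w (2 + L))
      ≤⟨ *-monoʳ-≤ (H ^ k) (step L) ⟩
    H ^ k * (h L ^ k * w L)
      ≡⟨ regroup (H ^ k) (h L ^ k) (w L) ⟩
    h L ^ k * H ^ k * w L
      ≡⟨ cong (_* w L) (sym (^-distribʳ-* (h L) H k)) ⟩
    (h L * H) ^ k * w L ∎
  where
  open ≤-Reasoning
  F H : ℕ
  F = stepProduct f s (2 + L)
  H = stepProduct h s (2 + L)
  shift : ∀ s L → 2 * suc s + L ≡ 2 * s + (2 + L)
  shift = solve-∀
  swap : ∀ x y z → x * (y * z) ≡ y * (x * z)
  swap = solve-∀
  regroup : ∀ x y z → x * (y * z) ≡ y * x * z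
  regroup = solve-∀

weight : ℕ → Tri → ℕ
weight zero    _            = 0
weight (suc d) leaf         = 10 ^ d
weight (suc d) (node a b c) = weight d a + (weight d b + weight d c)

weight-leaf : ∀ d → 10 * weight d leaf ≤ 10 ^ d
weight-leaf zero    = z≤n
weight-leaf (suc d) = ≤-refl

weight≡0⇒complete : ∀ d t → weight d t ≡ 0 → nodesAt d t ≡ 3 ^ d
weight≡0⇒complete zero    t            w≡0 = refl
weight≡0⇒complete (suc d) leaf         w≡0 = ⊥-elim (<⇒≢ (m^n>0 10 d) (sym w≡0))
weight≡0⇒complete (suc d) (node a b c) w≡0 =
  trans (cong₂ _+_ (weight≡0⇒complete d a wa≡0)
          (cong₂ _+_ (weight≡0⇒complete d b wb≡0) (weight≡0⇒complete d c wc≡0)))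
        (triple (3 ^ d))
  where
  wbc≡0 : weight d b + weight d c ≡ 0
  wbc≡0 = m+n≡0⇒n≡0 (weight d a) w≡0
  wa≡0 : weight d a ≡ 0
  wa≡0 = m+n≡0⇒m≡0 (weight d a) w≡0
  wb≡0 : weight d b ≡ 0
  wb≡0 = m+n≡0⇒m≡0 (weight d b) wbc≡0
  wc≡0 : weight d c ≡ 0
  wc≡0 = m+n≡0⇒n≡0 (weight d b) wbc≡0
  triple : ∀ x → x + (x + x) ≡ x + (x + (x + 0))
  triple = solve-∀

-- The drift inequality  10·Σ f + 7·w ≤ 10·m·w  survives adding the same
-- constant R to w and to every summand; inside a node, R is the weight of
-- the two subtrees that are not subdivided.
drift-plus-constant : ∀ m (f : Fin m → ℕ) w R →
  10 * sumFin m f + 7 * w ≤ 10 * m * w →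
  10 * sumFin m (λ i → f i + R) + 7 * w ≤ 10 * m * (w + R)
drift-plus-constant m f w R drift = begin
    10 * sumFin m (λ i → f i + R) + 7 * w
      ≡⟨ cong (λ x → 10 * x + 7 * w) (trans (sumFin-distrib-+ m f (λ _ → R)) (cong (S +_) (sumFin-const m R))) ⟩
    10 * (S + m * R) + 7 * w
      ≡⟨ separate S m R w ⟩
    (10 * S + 7 * w) + 10 * m * R
      ≤⟨ +-monoˡ-≤ (10 * m * R) drift ⟩
    10 * m * w + 10 * m * R
      ≡⟨ sym (*-distribˡ-+ (10 * m) w R) ⟩
    10 * m * (w + R) ∎
  where
  open ≤-Reasoning
  S : ℕ
  S = sumFin m f
  separate : ∀ S m R w → 10 * (S + m * R) + 7 * w ≡ (10 * S + 7 * w) + 10 * m * R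
  separate = solve-∀

-- Drift of the potential: summed over the L faces that may be subdivided,
-- the weight loses at least 7/10 of its value, since a leaf of weight w is
-- replaced by three leaves of total weight ≤ 3w/10.
weight-drift : ∀ d t →
  10 * sumFin (leaves t) (λ i → weight d (subdivide t i)) + 7 * weight d t
    ≤ 10 * leaves t * weight d t
weight-drift zero t rewrite sumFin-const (leaves t) 0 | *-zeroʳ (leaves t) = z≤n
weight-drift (suc d) leaf = begin
    10 * (w + (w + w) + 0) + 7 * 10 ^ d ≡⟨ split w (10 ^ d) ⟩
    3 * (10 * w) + 7 * 10 ^ d           ≤⟨ +-monoˡ-≤ (7 * 10 ^ d) (*-monoʳ-≤ 3 (weight-leaf d)) ⟩
    3 * 10 ^ d + 7 * 10 ^ d             ≡⟨ combine (10 ^ d) ⟩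
    10 * 1 * 10 ^ d                     ∎
  where
  open ≤-Reasoning
  w : ℕ
  w = weight d leaf
  split : ∀ w x → 10 * (w + (w + w) + 0) + 7 * x ≡ 3 * (10 * w) + 7 * x
  split = solve-∀
  combine : ∀ x → 3 * x + 7 * x ≡ 10 * 1 * x
  combine = solve-∀
weight-drift (suc d) (node a b c) = begin
    10 * sumFin (leaves (node a b c)) (λ i → weight (suc d) (subdivide (node a b c) i)) + 7 * W
      ≡⟨ cong (λ x → 10 * x + 7 * W) (trans (sumFin-subdivide-node a b c (weight (suc d)))
           (cong (Sa +_) (cong₂ _+_ (sumFin-cong lb (λ j → rot₁ wa (weight d (subdivide b j)) wc))
                                             (sumFin-cong lc (λ k → rot₂ wa wb (weight d (subdivide c k))))))) ⟩
    10 * (Sa + (Sb + Sc)) + 7 * (wa + (wb + wc))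
      ≡⟨ regroup Sa Sb Sc wa wb wc ⟩
    (10 * Sa + 7 * wa) + ((10 * Sb + 7 * wb) + (10 * Sc + 7 * wc))
      ≤⟨ +-mono-≤ (drift-plus-constant la _ wa (wb + wc) (weight-drift d a))
           (+-mono-≤ (drift-plus-constant lb _ wb (wa + wc) (weight-drift d b))
                     (drift-plus-constant lc _ wc (wa + wb) (weight-drift d c))) ⟩
    10 * la * (wa + (wb + wc)) + (10 * lb * (wb + (wa + wc)) + 10 * lc * (wc + (wa + wb)))
      ≡⟨ collect la lb lc wa wb wc ⟩
    10 * (la + (lb + lc)) * W ∎
  where
  open ≤-Reasoning
  la lb lc wa wb wc W Sa Sb Sc : ℕ
  la = leaves a
  lb = leaves b
  lc = leaves c
  wa = weight d a
  wb = weight d b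
  wc = weight d c
  W = wa + (wb + wc)
  Sa = sumFin la (λ i → weight d (subdivide a i) + (wb + wc))
  Sb = sumFin lb (λ j → weight d (subdivide b j) + (wa + wc))
  Sc = sumFin lc (λ k → weight d (subdivide c k) + (wa + wb))
  rot₁ : ∀ x y z → x + (y + z) ≡ y + (x + z)
  rot₁ = solve-∀
  rot₂ : ∀ x y z → x + (y + z) ≡ z + (x + y)
  rot₂ = solve-∀
  regroup : ∀ p q r x y z →
    10 * (p + (q + r)) + 7 * (x + (y + z)) ≡ (10 * p + 7 * x) + ((10 * q + 7 * y) + (10 * r + 7 * z))
  regroup = solve-∀
  collect : ∀ l m n x y z →
    10 * l * (x + (y + z)) + (10 * m * (y + (x + z)) + 10 * n * (z + (x + y))) ≡ 10 * (l + (m + n)) * (x + (y + z))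
  collect = solve-∀

-- Per step, the potential is multiplied by at most shrink L / (10 L).
shrink : ℕ → ℕ
shrink L = 10 * L ∸ 7

weight-contraction : ∀ d t →
  10 * sumFin (leaves t) (λ i → weight d (subdivide t i)) ≤ shrink (leaves t) * weight d t
weight-contraction d t =
  subst (10 * S ≤_) (sym (*-distribʳ-∸ (weight d t) (10 * leaves t) 7))
        (m+n≤o⇒m≤o∸n (10 * S) (weight-drift d t))
  where
  S : ℕ
  S = sumFin (leaves t) (λ i → weight d (subdivide t i))

weightRuns : ℕ → ℕ → Tri → ℕ
weightRuns d zero    t = weight d t
weightRuns d (suc s) t = sumFin (leaves t) (λ i → weightRuns d s (subdivide t i))

-- A run ending in an incomplete tree has final weight ≥ 1.
runs≤good+weight : ∀ d s t → totalRuns s t ≤ goodRuns d s t + weightRuns d s t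
runs≤good+weight d zero t with nodesAt d t ≟ 3 ^ d
... | yes _ = s≤s z≤n
... | no incomplete with weight d t ≟ 0
...   | yes w≡0 = ⊥-elim (incomplete (weight≡0⇒complete d t w≡0))
...   | no w≢0 = n≢0⇒n>0 w≢0
runs≤good+weight d (suc s) t =
  ≤-trans (sumFin-mono (leaves t) (λ i → runs≤good+weight d s (subdivide t i)))
          (≤-reflexive (sumFin-distrib-+ (leaves t) _ _))

failures≤weightRuns : ∀ d s t → totalRuns s t ∸ goodRuns d s t ≤ weightRuns d s t
failures≤weightRuns d s t = m≤n+o⇒m∸n≤o _ _ (runs≤good+weight d s t)

weightRuns-bound : ∀ d s t →
  10 ^ s * weightRuns d s t ≤ stepProduct shrink s (leaves t) * weight d t
weightRuns-bound d zero    t = ≤-refl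
weightRuns-bound d (suc s) t = begin
    10 * 10 ^ s * sumFin L (λ i → weightRuns d s (subdivide t i))
      ≡⟨ trans (*-assoc 10 (10 ^ s) _) (cong (10 *_) (sym (sumFin-*ˡ L (10 ^ s) _))) ⟩
    10 * sumFin L (λ i → 10 ^ s * weightRuns d s (subdivide t i))
      ≤⟨ *-monoʳ-≤ 10 (sumFin-mono L (λ i → ≤-trans (weightRuns-bound d s (subdivide t i))
            (≤-reflexive (cong (λ l → stepProduct shrink s l * weight d (subdivide t i)) (leaves-subdivide t i))))) ⟩
    10 * sumFin L (λ i → Q * weight d (subdivide t i))
      ≡⟨ trans (cong (10 *_) (sumFin-*ˡ L Q _)) (swap 10 Q _) ⟩
    Q * (10 * sumFin L (λ i → weight d (subdivide t i)))
      ≤⟨ *-monoʳ-≤ Q (weight-contraction d t) ⟩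
    Q * (shrink L * weight d t)
      ≡⟨ trans (swap Q (shrink L) (weight d t)) (sym (*-assoc (shrink L) Q (weight d t))) ⟩
    shrink L * Q * weight d t ∎
  where
  open ≤-Reasoning
  L Q : ℕ
  L = leaves t
  Q = stepProduct shrink s (2 + L)
  swap : ∀ x y z → x * (y * z) ≡ y * (x * z)
  swap = solve-∀

-- One step of the telescope:  (1 - 7/(10L))^3 ≤ (L+5)/(L+7).
cube-step : ∀ A c → 2 * A ≤ 21 * c → A ^ 3 * (2 + c) ≤ (7 + A) ^ 3 * c
cube-step A c 2A≤21c = begin
    A ^ 3 * (2 + c)                                          ≡⟨ e₁ A c ⟩
    A ^ 3 * c + 2 * A * (A * A)                              ≤⟨ +-monoʳ-≤ (A ^ 3 * c) (*-monoˡ-≤ (A * A) 2A≤21c) ⟩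
    A ^ 3 * c + 21 * c * (A * A)                             ≤⟨ m≤m+n _ _ ⟩
    A ^ 3 * c + 21 * c * (A * A) + (147 * A + 343) * c       ≡⟨ e₂ A c ⟩
    (7 + A) ^ 3 * c                                          ∎
  where
  open ≤-Reasoning
  -- x ^ 3 unfolds to x * (x * (x * 1)), the form the ring solver understands
  e₁ : ∀ x y → x * (x * (x * 1)) * (2 + y) ≡ x * (x * (x * 1)) * y + 2 * x * (x * x)
  e₁ = solve-∀
  e₂ : ∀ x y → x * (x * (x * 1)) * y + 21 * y * (x * x) + (147 * x + 343) * y
               ≡ (7 + x) * ((7 + x) * ((7 + x) * 1)) * y
  e₂ = solve-∀

shrink-step : ∀ L → shrink L ^ 3 * (5 + (2 + L)) ≤ (10 * L) ^ 3 * (5 + L)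
shrink-step zero    = z≤n
shrink-step (suc l) =
  subst₂ (λ a b → a ^ 3 * (8 + l) ≤ b ^ 3 * (6 + l)) (sym shrink≡) (sym (tenfold l))
         (cube-step (3 + 10 * l) (6 + l) (subst (2 * (3 + 10 * l) ≤_) (sym (slack l)) (m≤m+n _ _)))
  where
  tenfold : ∀ l → 10 * suc l ≡ 7 + (3 + 10 * l)
  tenfold = solve-∀
  shrink≡ : shrink (suc l) ≡ 3 + 10 * l
  shrink≡ = trans (cong (_∸ 7) (tenfold l)) (m+n∸m≡n 7 _)
  slack : ∀ l → 21 * (6 + l) ≡ 2 * (3 + 10 * l) + (120 + l)
  slack = solve-∀

shrink-telescope : ∀ s →
  stepProduct shrink s 1 ^ 3 * (5 + (2 * s + 1)) ≤ stepProduct (10 *_) s 1 ^ 3 * 6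
shrink-telescope s = stepProduct-telescope shrink (10 *_) (5 +_) 3 shrink-step s 1

root-≤ : ∀ k {a b} → a ^ suc k ≤ b ^ suc k → a ≤ b
root-≤ k {a} {b} aᵏ≤bᵏ with a ≤? b
... | yes a≤b = a≤b
... | no  a≰b = ⊥-elim (<⇒≱ (^-monoˡ-< (suc k) (≰⇒> a≰b)) aᵏ≤bᵏ)

-- Failed runs, scaled by 10^s, are at most the shrunken product times
-- 10^d, which bounds the weight of the initial face.
failures-scaled : ∀ d s →
  10 ^ s * (totalRuns s leaf ∸ goodRuns d s leaf) ≤ stepProduct shrink s 1 * 10 ^ d
failures-scaled d s =
  ≤-trans (*-monoʳ-≤ (10 ^ s) (failures≤weightRuns d s leaf))
    (≤-trans (weightRuns-bound d s leaf)
             (*-monoʳ-≤ (stepProduct shrink s 1) (≤-trans (m≤n*m (weight d leaf) 10) (weight-leaf d))))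

shrink-product-ratio : ∀ s a → 3 * a ^ 3 ≤ 3 + s →
  a * stepProduct shrink s 1 ≤ stepProduct (10 *_) s 1
shrink-product-ratio s a 3a³≤3+s = root-≤ 2 (*-cancelʳ-≤ _ _ w (begin
    (a * Q) ^ 3 * w                   ≡⟨ trans (cong (_* w) (^-distribʳ-* a Q 3)) (*-assoc (a ^ 3) (Q ^ 3) w) ⟩
    a ^ 3 * (Q ^ 3 * w)               ≤⟨ *-monoʳ-≤ (a ^ 3) (shrink-telescope s) ⟩
    a ^ 3 * (P ^ 3 * 6)               ≡⟨ regroup (a ^ 3) (P ^ 3) ⟩
    P ^ 3 * (2 * (3 * a ^ 3))         ≤⟨ *-monoʳ-≤ (P ^ 3) (*-monoʳ-≤ 2 3a³≤3+s) ⟩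
    P ^ 3 * (2 * (3 + s))             ≡⟨ cong (P ^ 3 *_) (double s) ⟩
    P ^ 3 * w                         ∎))
  where
  open ≤-Reasoning
  Q P w : ℕ
  Q = stepProduct shrink s 1
  P = stepProduct (10 *_) s 1
  w = 5 + (2 * s + 1)
  regroup : ∀ x y → x * (y * 6) ≡ y * (2 * (3 * x))
  regroup = solve-∀
  double : ∀ s → 2 * (3 + s) ≡ 5 + (2 * s + 1)
  double = solve-∀

failure-bound : ∀ d s c → 3 * (c * 10 ^ d) ^ 3 ≤ 3 + s →
  (totalRuns s leaf ∸ goodRuns d s leaf) * c ≤ totalRuns s leaf
failure-bound d s c 3a³≤3+s = *-cancelˡ-≤ (10 ^ s) {{m^n≢0 10 s}} (begin
    10 ^ s * (F * c)                    ≡⟨ sym (*-assoc (10 ^ s) F c) ⟩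
    10 ^ s * F * c                      ≤⟨ *-monoˡ-≤ c (failures-scaled d s) ⟩
    Q * 10 ^ d * c                      ≡⟨ rearrange Q (10 ^ d) c ⟩
    c * 10 ^ d * Q                      ≤⟨ shrink-product-ratio s (c * 10 ^ d) 3a³≤3+s ⟩
    stepProduct (10 *_) s 1             ≡⟨ sym (stepProduct-scale 10 (λ L → L) s 1) ⟩
    10 ^ s * stepProduct (λ L → L) s 1  ≡⟨ cong (10 ^ s *_) (sym (totalRuns-product s leaf)) ⟩
    10 ^ s * totalRuns s leaf           ∎)
  where
  open ≤-Reasoning
  F Q : ℕ
  F = totalRuns s leaf ∸ goodRuns d s leaf
  Q = stepProduct shrink s 1
  rearrange : ∀ x y z → x * y * z ≡ z * y * x
  rearrange = solve-∀

C2-suc : ∀ n → suc n C 2 ≡ n + n C 2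
C2-suc n = trans (sym (nCk+nC[k+1]≡[n+1]C[k+1] n 1)) (cong (_+ n C 2) (nC1≡n n))

C3-suc : ∀ n → suc n C 3 ≡ n C 2 + n C 3
C3-suc n = sym (nCk+nC[k+1]≡[n+1]C[k+1] n 2)

-- Closed forms without subtraction: 2·C(n,2) = n² - n, 6·C(n,3) = n³ - 3n² + 2n.
C2-closed : ∀ n → 2 * (n C 2) + n ≡ n * n
C2-closed zero    = refl
C2-closed (suc n) = begin
    2 * (suc n C 2) + suc n        ≡⟨ cong (λ x → 2 * x + suc n) (C2-suc n) ⟩
    2 * (n + n C 2) + suc n        ≡⟨ regroup n (n C 2) ⟩
    2 * (n C 2) + n + (2 * n + 1)  ≡⟨ cong (_+ (2 * n + 1)) (C2-closed n) ⟩
    n * n + (2 * n + 1)            ≡⟨ square n ⟩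
    suc n * suc n                  ∎
  where
  open ≡-Reasoning
  regroup : ∀ n x → 2 * (n + x) + suc n ≡ 2 * x + n + (2 * n + 1)
  regroup = solve-∀
  square : ∀ n → n * n + (2 * n + 1) ≡ suc n * suc n
  square = solve-∀

C3-closed : ∀ n → 6 * (n C 3) + 3 * (n * n) ≡ n * n * n + 2 * n
C3-closed zero    = refl
C3-closed (suc n) = begin
    6 * (suc n C 3) + 3 * (suc n * suc n)
      ≡⟨ cong (λ x → 6 * x + 3 * (suc n * suc n)) (C3-suc n) ⟩
    6 * (n C 2 + n C 3) + 3 * (suc n * suc n)
      ≡⟨ regroup n (n C 2) (n C 3) ⟩
    (6 * (n C 3) + 3 * (n * n)) + 3 * (2 * (n C 2) + n) + (3 * n + 3)
      ≡⟨ cong₂ (λ x y → x + 3 * y + (3 * n + 3)) (C3-closed n) (C2-closed n) ⟩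
    (n * n * n + 2 * n) + 3 * (n * n) + (3 * n + 3)
      ≡⟨ cube n ⟩
    suc n * suc n * suc n + 2 * suc n ∎
  where
  open ≡-Reasoning
  regroup : ∀ n x y → 6 * (x + y) + 3 * (suc n * suc n) ≡ (6 * y + 3 * (n * n)) + 3 * (2 * x + n) + (3 * n + 3)
  regroup = solve-∀
  cube : ∀ n → (n * n * n + 2 * n) + 3 * (n * n) + (3 * n + 3) ≡ suc n * suc n * suc n + 2 * suc n
  cube = solve-∀

-- Σ_{i ≤ 3} C(m,i)·k^(3-i): the binomial expansion of k^(3-m)·(k+1)^m
-- truncated after the cubic term.
binomial3 : ℕ → ℕ → ℕ
binomial3 k m = k ^ 3 + m * k ^ 2 + (m C 2) * k + m C 3

binomial3-bound : ∀ k m → k ^ m * binomial3 k m ≤ k ^ 3 * suc k ^ m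
binomial3-bound k zero    = ≤-reflexive (base k)
  where
  base : ∀ k → 1 * (k * (k * (k * 1)) + 0 * (k * (k * 1)) + 0 * k + 0) ≡ k * (k * (k * 1)) * 1
  base = solve-∀
binomial3-bound k (suc m) = begin
    k ^ suc m * binomial3 k (suc m)
      ≤⟨ m≤m+n _ _ ⟩
    k ^ suc m * binomial3 k (suc m) + k ^ m * (m C 3)
      ≡⟨ cong (λ b → k ^ suc m * b + k ^ m * (m C 3))
              (cong₂ (λ x y → k ^ 3 + suc m * k ^ 2 + x * k + y) (C2-suc m) (C3-suc m)) ⟩
    k * k ^ m * (k ^ 3 + suc m * k ^ 2 + (m + m C 2) * k + (m C 2 + m C 3)) + k ^ m * (m C 3)
      ≡⟨ pascal k (k ^ m) m (m C 2) (m C 3) ⟩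
    suc k * (k ^ m * binomial3 k m)
      ≤⟨ *-monoʳ-≤ (suc k) (binomial3-bound k m) ⟩
    suc k * (k ^ 3 * suc k ^ m)
      ≡⟨ swap (suc k) (k ^ 3) (suc k ^ m) ⟩
    k ^ 3 * suc k ^ suc m ∎
  where
  open ≤-Reasoning
  pascal : ∀ k x m c₂ c₃ →
    k * x * (k * (k * (k * 1)) + suc m * (k * (k * 1)) + (m + c₂) * k + (c₂ + c₃)) + x * c₃
      ≡ suc k * (x * (k * (k * (k * 1)) + m * (k * (k * 1)) + c₂ * k + c₃))
  pascal = solve-∀
  swap : ∀ x y z → x * (y * z) ≡ y * (x * z)
  swap = solve-∀

binomial3-diagonal : ∀ k → 60 ≤ k → 53 * k ^ 3 ≤ 20 * binomial3 k k
binomial3-diagonal k 60≤k = *-cancelˡ-≤ 6 (+-cancelʳ-≤ (120 * (k * k)) _ _ (begin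
    6 * (53 * k ^ 3) + 120 * (k * k)   ≤⟨ +-monoʳ-≤ (6 * (53 * k ^ 3)) k²-small ⟩
    6 * (53 * k ^ 3) + 2 * k ^ 3       ≤⟨ m≤m+n _ (40 * k) ⟩
    6 * (53 * k ^ 3) + 2 * k ^ 3 + 40 * k ≡⟨ collect k ⟩
    320 * k ^ 3 + 40 * k               ≡⟨ sym diagonal-value ⟩
    6 * (20 * binomial3 k k) + 120 * (k * k) ∎))
  where
  open ≤-Reasoning
  k²-small : 120 * (k * k) ≤ 2 * k ^ 3
  k²-small = subst₂ _≤_ (sym (*-assoc 2 60 (k * k))) (twice-cube k)
                     (*-monoʳ-≤ 2 (*-monoˡ-≤ (k * k) 60≤k))
    where
    twice-cube : ∀ k → 2 * (k * (k * k)) ≡ 2 * (k * (k * (k * 1)))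
    twice-cube = solve-∀
  collect : ∀ k → 6 * (53 * (k * (k * (k * 1)))) + 2 * (k * (k * (k * 1))) + 40 * k ≡ 320 * (k * (k * (k * 1))) + 40 * k
  collect = solve-∀
  expand : ∀ k c₂ c₃ →
    6 * (20 * (k * (k * (k * 1)) + k * (k * (k * 1)) + c₂ * k + c₃)) + 120 * (k * k)
      ≡ 240 * (k * k * k) + 60 * k * (2 * c₂ + k) + 20 * (6 * c₃ + 3 * (k * k))
  expand = solve-∀
  finish : ∀ k → 240 * (k * k * k) + 60 * k * (k * k) + 20 * (k * k * k + 2 * k) ≡ 320 * (k * (k * (k * 1))) + 40 * k
  finish = solve-∀
  diagonal-value : 6 * (20 * binomial3 k k) + 120 * (k * k) ≡ 320 * k ^ 3 + 40 * k
  diagonal-value = trans (expand k (k C 2) (k C 3))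
    (trans (cong₂ (λ x y → 240 * (k * k * k) + 60 * k * x + 20 * y) (C2-closed k) (C3-closed k)) (finish k))

compound-interest : ∀ k → 60 ≤ k → 53 * k ^ k ≤ 20 * suc k ^ k
compound-interest k 60≤k = *-cancelʳ-≤ _ _ (k ^ 3) {{m^n≢0 k 3 {{k≢0}}}} (begin
    53 * k ^ k * k ^ 3                 ≡⟨ swap₁ (k ^ k) (k ^ 3) ⟩
    k ^ k * (53 * k ^ 3)               ≤⟨ *-monoʳ-≤ (k ^ k) (binomial3-diagonal k 60≤k) ⟩
    k ^ k * (20 * binomial3 k k)       ≡⟨ swap₂ (k ^ k) (binomial3 k k) ⟩
    20 * (k ^ k * binomial3 k k)       ≤⟨ *-monoʳ-≤ 20 (binomial3-bound k k) ⟩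
    20 * (k ^ 3 * suc k ^ k)           ≡⟨ swap₃ (k ^ 3) (suc k ^ k) ⟩
    20 * suc k ^ k * k ^ 3             ∎)
  where
  open ≤-Reasoning
  k≢0 : NonZero k
  k≢0 = >-nonZero (≤-trans (s≤s z≤n) 60≤k)
  swap₁ : ∀ x y → 53 * x * y ≡ x * (53 * y)
  swap₁ = solve-∀
  swap₂ : ∀ x y → x * (20 * y) ≡ 20 * (x * y)
  swap₂ = solve-∀
  swap₃ : ∀ x y → 20 * (x * y) ≡ 20 * y * x
  swap₃ = solve-∀

fact-nonZero : ∀ N → NonZero (fact N)
fact-nonZero zero    = _
fact-nonZero (suc N) = m*n≢0 (suc N) (fact N) {{_}} {{fact-nonZero N}}

stirNum stirDen : ℕ
stirNum = 60 ^ 60 * 20 ^ 60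
stirDen = fact 60 * 53 ^ 60

stirNum-nonZero : NonZero stirNum
stirNum-nonZero = m*n≢0 (60 ^ 60) (20 ^ 60) {{m^n≢0 60 60}} {{m^n≢0 20 60}}

stirDen-nonZero : NonZero stirDen
stirDen-nonZero = m*n≢0 (fact 60) (53 ^ 60) {{fact-nonZero 60}} {{m^n≢0 53 60}}

-- Stirling-type bound  x^x / x! ≥ c₀ · (53/20)^x  for x ≥ 60: the ratio
-- (x+1)^(x+1)/(x+1)! ÷ x^x/x! equals (1 + 1/x)^x ≥ 53/20.
stirling-lower : ∀ t →
  53 ^ (t + 60) * fact (t + 60) * stirNum ≤ 20 ^ (t + 60) * (t + 60) ^ (t + 60) * stirDen
stirling-lower zero    = ≤-reflexive (exchange (53 ^ 60) (fact 60) (60 ^ 60) (20 ^ 60))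
  where
  exchange : ∀ a b c d → a * b * (c * d) ≡ d * c * (b * a)
  exchange = solve-∀
stirling-lower (suc t) = begin
    53 * 53 ^ k * (suc k * fact k) * stirNum         ≡⟨ split₁ (53 ^ k) (fact k) stirNum k ⟩
    (53 * suc k) * (53 ^ k * fact k * stirNum)       ≤⟨ *-monoʳ-≤ (53 * suc k) (stirling-lower t) ⟩
    (53 * suc k) * (20 ^ k * k ^ k * stirDen)        ≡⟨ split₂ (20 ^ k) (k ^ k) stirDen k ⟩
    (suc k * 20 ^ k * stirDen) * (53 * k ^ k)        ≤⟨ *-monoʳ-≤ (suc k * 20 ^ k * stirDen) (compound-interest k (m≤n+m 60 t)) ⟩
    (suc k * 20 ^ k * stirDen) * (20 * suc k ^ k)    ≡⟨ split₃ (20 ^ k) (suc k ^ k) stirDen k ⟩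
    20 * 20 ^ k * (suc k * suc k ^ k) * stirDen      ∎
  where
  open ≤-Reasoning
  k : ℕ
  k = t + 60
  split₁ : ∀ x f z k → 53 * x * (suc k * f) * z ≡ (53 * suc k) * (x * f * z)
  split₁ = solve-∀
  split₂ : ∀ y p z k → (53 * suc k) * (y * p * z) ≡ (suc k * y * z) * (53 * p)
  split₂ = solve-∀
  split₃ : ∀ y q z k → (suc k * y * z) * (20 * q) ≡ 20 * y * (suc k * q) * z
  split₃ = solve-∀

power≤expS : ∀ x N → x ^ N ≤ expS x N
power≤expS x zero    = ≤-refl
power≤expS x (suc N) = m≤n+m _ _

expLe-lower : ∀ x y → 60 ≤ x → ExpLe x y → 53 ^ x * stirNum ≤ 20 ^ x * y * stirDen
expLe-lower x y 60≤x eˣ≤y = *-cancelʳ-≤ _ _ (fact x) {{fact-nonZero x}} (begin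
    53 ^ x * stirNum * fact x          ≡⟨ swap (53 ^ x) stirNum (fact x) ⟩
    53 ^ x * fact x * stirNum          ≤⟨ stirling-x ⟩
    20 ^ x * x ^ x * stirDen           ≤⟨ *-monoˡ-≤ stirDen (*-monoʳ-≤ (20 ^ x) xˣ≤y·x!) ⟩
    20 ^ x * (y * fact x) * stirDen    ≡⟨ regroup (20 ^ x) y (fact x) stirDen ⟩
    20 ^ x * y * stirDen * fact x      ∎)
  where
  open ≤-Reasoning
  stirling-x : 53 ^ x * fact x * stirNum ≤ 20 ^ x * x ^ x * stirDen
  stirling-x = subst (λ z → 53 ^ z * fact z * stirNum ≤ 20 ^ z * z ^ z * stirDen)
                     (m∸n+n≡m 60≤x) (stirling-lower (x ∸ 60))
  xˣ≤y·x! : x ^ x ≤ y * fact x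
  xˣ≤y·x! = ≤-trans (power≤expS x x) (eˣ≤y x)
  swap : ∀ a b c → a * b * c ≡ a * c * b
  swap = solve-∀
  regroup : ∀ a b c d → a * (b * c) * d ≡ a * b * d * c
  regroup = solve-∀

ratio-100 : 2 * 10 ^ 42 * 20 ^ 100 ≤ 53 ^ 100
ratio-100 = ≤ᵇ⇒≤ (2 * 10 ^ 42 * 20 ^ 100) (53 ^ 100) tt

expLe-100 : ∀ D y → 1 ≤ D → ExpLe (100 * D) y → 2 ^ D * 10 ^ (42 * D) * stirNum ≤ y * stirDen
expLe-100 D y 1≤D e¹⁰⁰ᴰ≤y = *-cancelʳ-≤ _ _ (20 ^ x) {{m^n≢0 20 x}} (begin
    2 ^ D * 10 ^ (42 * D) * stirNum * 20 ^ x   ≡⟨ swap (2 ^ D * 10 ^ (42 * D)) stirNum (20 ^ x) ⟩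
    2 ^ D * 10 ^ (42 * D) * 20 ^ x * stirNum   ≤⟨ *-monoˡ-≤ stirNum powers ⟩
    53 ^ x * stirNum                           ≤⟨ expLe-lower x y 60≤x e¹⁰⁰ᴰ≤y ⟩
    20 ^ x * y * stirDen                       ≡⟨ rotate (20 ^ x) y stirDen ⟩
    y * stirDen * 20 ^ x                       ∎)
  where
  open ≤-Reasoning
  x : ℕ
  x = 100 * D
  60≤x : 60 ≤ x
  60≤x = ≤-trans (≤ᵇ⇒≤ 60 100 tt) (m≤m*n 100 D {{>-nonZero 1≤D}})
  powers : 2 ^ D * 10 ^ (42 * D) * 20 ^ x ≤ 53 ^ x
  powers = begin
    2 ^ D * 10 ^ (42 * D) * 20 ^ x
      ≡⟨ sym (cong₂ (λ u v → 2 ^ D * u * v) (^-*-assoc 10 42 D) (^-*-assoc 20 100 D)) ⟩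
    2 ^ D * (10 ^ 42) ^ D * (20 ^ 100) ^ D
      ≡⟨ sym (trans (^-distribʳ-* (2 * 10 ^ 42) (20 ^ 100) D)
                    (cong (_* (20 ^ 100) ^ D) (^-distribʳ-* 2 (10 ^ 42) D))) ⟩
    (2 * 10 ^ 42 * 20 ^ 100) ^ D
      ≤⟨ ^-monoˡ-≤ D ratio-100 ⟩
    (53 ^ 100) ^ D
      ≡⟨ ^-*-assoc 53 100 D ⟩
    53 ^ x ∎
  swap : ∀ a b c → a * b * c ≡ a * c * b
  swap = solve-∀
  rotate : ∀ a b c → a * b * c ≡ b * c * a
  rotate = solve-∀

n<2^n : ∀ n → n < 2 ^ n
n<2^n zero    = s≤s z≤n
n<2^n (suc n) = ≤-trans (+-mono-≤ (m^n>0 2 n) (n<2^n n))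
                        (≤-reflexive (cong (2 ^ n +_) (sym (+-identityʳ (2 ^ n)))))

n≤n^7 : ∀ n → n ≤ n ^ 7
n≤n^7 zero    = z≤n
n≤n^7 (suc n) = m≤m*n (suc n) (suc n ^ 6) {{m^n≢0 (suc n) 6}}

-- Taking 7th powers, this is K·10^(42 D) ≤ n^7 with
-- K = (3c^3)^7.  For D ≤ M this holds as soon as n ≥ N = K·10^(42 M); for
-- larger D, e^(100 D) ≤ n^7 gives c₀ · 2^D · 10^(42 D) ≤ n^7 and 2^D beats K/c₀.
module Threshold (c : ℕ) where
  K M N : ℕ
  K = (3 * c ^ 3) ^ 7
  M = K * stirDen
  N = K * 10 ^ (42 * M)

  seventh-power : ∀ D → (3 * (c * 10 ^ (2 * D)) ^ 3) ^ 7 ≡ K * 10 ^ (42 * D)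
  seventh-power D = begin
      (3 * (c * b) ^ 3) ^ 7      ≡⟨ cong (λ z → (3 * z) ^ 7) (^-distribʳ-* c b 3) ⟩
      (3 * (c ^ 3 * b ^ 3)) ^ 7  ≡⟨ cong (_^ 7) (sym (*-assoc 3 (c ^ 3) (b ^ 3))) ⟩
      (3 * c ^ 3 * b ^ 3) ^ 7    ≡⟨ ^-distribʳ-* (3 * c ^ 3) (b ^ 3) 7 ⟩
      K * (b ^ 3) ^ 7            ≡⟨ cong (K *_) (trans (^-*-assoc b 3 7) (^-*-assoc 10 (2 * D) 21)) ⟩
      K * 10 ^ (2 * D * 21)      ≡⟨ cong (λ e → K * 10 ^ e) (exponent D) ⟩
      K * 10 ^ (42 * D)          ∎
    where
    open ≡-Reasoning
    b : ℕ
    b = 10 ^ (2 * D)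
    exponent : ∀ D → 2 * D * 21 ≡ 42 * D
    exponent = solve-∀

  small : ∀ n D → N ≤ n → D ≤ M → K * 10 ^ (42 * D) ≤ n ^ 7
  small n D N≤n D≤M = begin
      K * 10 ^ (42 * D)  ≤⟨ *-monoʳ-≤ K (^-monoʳ-≤ 10 (*-monoʳ-≤ 42 D≤M)) ⟩
      N                  ≤⟨ N≤n ⟩
      n                  ≤⟨ n≤n^7 n ⟩
      n ^ 7              ∎
    where open ≤-Reasoning

  large : ∀ n D → 1 ≤ D → M ≤ 2 ^ D * stirNum → ExpLe (100 * D) (n ^ 7) →
          K * 10 ^ (42 * D) ≤ n ^ 7
  large n D 1≤D M≤ e¹⁰⁰ᴰ≤n⁷ = *-cancelʳ-≤ _ _ stirDen {{stirDen-nonZero}} (begin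
      K * 10 ^ (42 * D) * stirDen       ≡⟨ rotate K (10 ^ (42 * D)) stirDen ⟩
      10 ^ (42 * D) * M                 ≤⟨ *-monoʳ-≤ (10 ^ (42 * D)) M≤ ⟩
      10 ^ (42 * D) * (2 ^ D * stirNum) ≡⟨ regroup (10 ^ (42 * D)) (2 ^ D) stirNum ⟩
      2 ^ D * 10 ^ (42 * D) * stirNum   ≤⟨ expLe-100 D (n ^ 7) 1≤D e¹⁰⁰ᴰ≤n⁷ ⟩
      n ^ 7 * stirDen                   ∎)
    where
    open ≤-Reasoning
    rotate : ∀ k t w → k * t * w ≡ t * (k * w)
    rotate = solve-∀
    regroup : ∀ t p z → t * (p * z) ≡ p * t * z
    regroup = solve-∀

  -- if D is not small then D < 2^D ≤ 2^D · stirNum < M, so D is large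
  bound : ∀ n → N ≤ n → ∀ D → ExpLe (100 * D) (n ^ 7) → K * 10 ^ (42 * D) ≤ n ^ 7
  bound n N≤n zero        _ = small n zero N≤n z≤n
  bound n N≤n D@(suc _) e¹⁰⁰ᴰ≤n⁷ with M ≤? 2 ^ D * stirNum
  ... | yes M≤ = large n D (s≤s z≤n) M≤ e¹⁰⁰ᴰ≤n⁷
  ... | no  M≰ = small n D N≤n (<⇒≤ (<-≤-trans (n<2^n D)
                   (≤-trans (m≤m*n (2 ^ D) stirNum {{stirNum-nonZero}}) (<⇒≤ (≰⇒> M≰)))))

  D-small : ∀ n → N ≤ n → ∀ D → IsD n D → 3 * (c * 10 ^ (2 * D)) ^ 3 ≤ n
  D-small n N≤n D isD =
    root-≤ 6 (subst (_≤ n ^ 7) (sym (seventh-power D)) (bound n N≤n D (proj₁ isD)))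

corollary8 : ∀ (m : ℕ) → ∃ λ N → ∀ n → N ≤ n → ∀ D → IsD n D →
                 (totalRuns (n ∸ 3) leaf ∸ goodRuns (2 * D) (n ∸ 3) leaf) * suc m
                   ≤ totalRuns (n ∸ 3) leaf
corollary8 m = 3 + N , λ n 3+N≤n D isD →
  failure-bound (2 * D) (n ∸ 3) (suc m)
    (subst (3 * (suc m * 10 ^ (2 * D)) ^ 3 ≤_) (sym (m+[n∸m]≡n (≤-trans (m≤m+n 3 N) 3+N≤n)))
           (D-small n (≤-trans (m≤n+m N 3) 3+N≤n) D isD))
  where open Threshold (suc m)
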